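{- For every cathoristic logic formula $\phi$ and every cathoristic model $\mathfrak{M}$: if $\mathfrak{M}\models\phi$ then $\mathfrak{M}\preceq\mathrm{Simpl}(\phi)$.
   Context: Fix a non-empty set $\Sigma$ of actions. Formulae: $\phi ::= \top \mid \phi\land\psi \mid \langle a\rangle\phi \mid\ !A$ with $a\in\Sigma$, $A$ a finite subset of $\Sigma$. A cathoristic transition system is $\mathcal{L}=(S,\rightarrow,\lambda)$ with $\rightarrow\subseteq S\times\Sigma\times S$ deterministic and $\lambda:S\to\mathcal{P}(\Sigma)$ such that $\{a\mid\exists t.\,s\xrightarrow{a}t\}\subseteq\lambda(s)$ and each $\lambda(s)$ is finite or $\Sigma$; a cathoristic model is $(\mathcal{L},s)$, $s\in S$. Satisfaction: $\top$ always; $\land$ componentwise; $(\mathcal{L},s)\models\langle a\rangle\phi$ iff some $s\xrightarrow{a}t$ has $(\mathcal{L},t)\models\phi$; $(\mathcal{L},s)\models\ !A$ iff $\lambda(s)\subseteq A$. A simulation from $(\mathcal{L}_1,s_1)$ to $(\mathcal{L}_2,s_2)$ is $R\subseteq S_1\times S_2$ containing $(s_1,s_2)$ such that whenever $(x,y)\in R$ and $x\xrightarrow{a}_1x'$ there is $y'$ with $y\xrightarrow{a}_2y'$, $(x',y')\in R$, and $\lambda_1(x)\supseteq\lambda_2(y)$ for all $(x,y)\in R$. $\mathfrak{M}\preceq\mathfrak{M}'$ iff there is a simulation from $\mathfrak{M}'$ to $\mathfrak{M}$; $\simeq$ is $\preceq\cap\preceq^{ -1}$. Models are considered up to $\simeq$,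 and a bottom element $\bot$ is added with $\bot\preceq\mathfrak{M}$ for all $\mathfrak{M}$ and $\bot\models\phi$ for all $\phi$; the resulting ordered collection is a bounded lattice, and $\mathrm{glb}(\mathfrak{M},\mathfrak{M}')$ denotes the greatest lower bound in it. $\mathrm{Simpl}$: $\mathrm{Simpl}(\top)=((\{v\},\emptyset,\{v\mapsto\Sigma\}),v)$; $\mathrm{Simpl}(!A)=((\{v\},\emptyset,\{v\mapsto A\}),v)$; $\mathrm{Simpl}(\phi_1\land\phi_2)=\mathrm{glb}(\mathrm{Simpl}(\phi_1),\mathrm{Simpl}(\phi_2))$; $\mathrm{Simpl}(\langle a\rangle\phi)=\bot$ if $\mathrm{Simpl}(\phi)=\bot$, and otherwise, with $\mathrm{Simpl}(\phi)=((S,\rightarrow,\lambda),w)$, $\mathrm{Simpl}(\langle a\rangle\phi)=((S\cup\{w'\},\rightarrow\cup\{(w',a,w)\},\lambda\cup\{w'\mapsto\Sigma\}),w')$ for a fresh $w'\notin S$. -}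

module Defs where

open import Level using (Level; suc; zero)
open import Data.Unit using (⊤; tt)
open import Data.Empty using (⊥)
open import Data.Maybe using (Maybe; just; nothing)
open import Data.Product using (Σ; _×_; _,_; ∃)
open import Data.List using (List)
open import Data.List.Membership.Propositional using (_∈_)
open import Relation.Binary.PropositionalEquality using (_≡_; refl; trans; sym)

-- Cathoristic logic over a fixed set of actions Act (the paper's Σ).
module Cath (Act : Set) where

  -- Labels λ(s): either all of Act, or a finite subset (given by a list).
  data Label : Set where
    all : Label
    fin : List Act → Label

  _∈L_ : Act → Label → Set
  a ∈L all = ⊤
  a ∈L fin xs = a ∈ xs

  _⊆L_ : Label → Label → Set
  l ⊆L m = ∀ a → a ∈L l → a ∈L m

  data Form : Set where
    tt′  : Form
    _∧′_ : Form → Form → Form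
    ⟨_⟩_ : Act → Form → Form
    !_   : List Act → Form

  record CTS : Set₁ where
    field
      State : Set
      _—_⟶_ : State → Act → State → Set
      determ : ∀ {s a t t′} → s — a ⟶ t → s — a ⟶ t′ → t ≡ t′
      lab : State → Label
      enabled⊆lab : ∀ {s a t} → s — a ⟶ t → a ∈L lab s
  open CTS public

  Model : Set₁
  Model = Σ CTS State

  _∣_⊨_ : (L : CTS) → State L → Form → Set
  L ∣ s ⊨ tt′ = ⊤
  L ∣ s ⊨ (φ ∧′ ψ) = (L ∣ s ⊨ φ) × (L ∣ s ⊨ ψ)
  L ∣ s ⊨ (⟨ a ⟩ φ) = Σ (State L) λ t → (_—_⟶_ L s a t) × (L ∣ t ⊨ φ)
  L ∣ s ⊨ (! A) = lab L s ⊆L fin A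

  _⊨_ : Model → Form → Set
  (L , s) ⊨ φ = L ∣ s ⊨ φ

  record IsSimulation (M₁ M₂ : Model) (R : State (Σ.proj₁ M₁) → State (Σ.proj₁ M₂) → Set) : Set where
    private
      L₁ = Σ.proj₁ M₁
      L₂ = Σ.proj₁ M₂
    field
      root : R (Σ.proj₂ M₁) (Σ.proj₂ M₂)
      step : ∀ {x y a x′} → R x y → _—_⟶_ L₁ x a x′ →
             Σ (State L₂) λ y′ → (_—_⟶_ L₂ y a y′) × R x′ y′
      labels : ∀ {x y} → R x y → lab L₂ y ⊆L lab L₁ x

  Simulation : Model → Model → Set₁
  Simulation M₁ M₂ = Σ (State (Σ.proj₁ M₁) → State (Σ.proj₁ M₂) → Set) (IsSimulation M₁ M₂)

  _⪯_ : Model → Model → Set₁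
  M ⪯ M′ = Simulation M′ M

  -- Models extended with a bottom element: nothing = ⊥
  ModelB : Set₁
  ModelB = Maybe Model

  _⪯B_ : ModelB → ModelB → Set₁
  nothing ⪯B _ = Level.Lift _ ⊤
  just M ⪯B nothing = Level.Lift _ ⊥
  just M ⪯B just M′ = M ⪯ M′

  _⊨B_ : ModelB → Form → Set
  nothing ⊨B φ = ⊤
  just M ⊨B φ = M ⊨ φ

  record IsGlb (x y z : ModelB) : Set₂ where
    field
      lb₁ : z ⪯B x
      lb₂ : z ⪯B y
      greatest : ∀ w → w ⪯B x → w ⪯B y → w ⪯B z

  single : Label → Model
  single l = record
    { State = ⊤
    ; _—_⟶_ = λ _ _ _ → ⊥
    ; determ = λ ()
    ; lab = λ _ → l
    ; enabled⊆lab = λ ()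
    } , tt

  -- Simpl(⟨a⟩φ) from Simpl(φ) = (L , w): add a fresh root w′ with w′ -a-> w, λ(w′) = Act
  module _ (L : CTS) (w : State L) (a : Act) where
    data ExtStep : Maybe (State L) → Act → Maybe (State L) → Set where
      old : ∀ {s b t} → _—_⟶_ L s b t → ExtStep (just s) b (just t)
      new : ExtStep nothing a (just w)

    extDeterm : ∀ {s b t t′} → ExtStep s b t → ExtStep s b t′ → t ≡ t′
    extDeterm (old p) (old q) with determ L p q
    ... | refl = refl
    extDeterm new new = refl

    extLab : Maybe (State L) → Label
    extLab nothing = all
    extLab (just s) = lab L s

    extEn : ∀ {s b t} → ExtStep s b t → b ∈L extLab s
    extEn (old p) = enabled⊆lab L p
    extEn new = tt

    extendCTS : CTS
    extendCTS = record
      { State = Maybe (State L)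
      ; _—_⟶_ = ExtStep
      ; determ = extDeterm
      ; lab = extLab
      ; enabled⊆lab = extEn
      }

  prefix : Act → Model → Model
  prefix a (L , w) = extendCTS L w a , nothing

  -- IsSimpl φ x : x is (a representative of) Simpl(φ); glb is taken in the lattice.
  data IsSimpl : Form → ModelB → Set₂ where
    s-top  : IsSimpl tt′ (just (single all))
    s-bang : ∀ A → IsSimpl (! A) (just (single (fin A)))
    s-and  : ∀ {φ ψ x y z} → IsSimpl φ x → IsSimpl ψ y → IsGlb x y z → IsSimpl (φ ∧′ ψ) z
    s-diaB : ∀ {a φ} → IsSimpl φ nothing → IsSimpl (⟨ a ⟩ φ) nothing
    s-dia  : ∀ {a φ M} → IsSimpl φ (just M) → IsSimpl (⟨ a ⟩ φ) (just (prefix a M))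

module Submission where

-- The proof is by induction on the derivation of  IsSimpl φ S , using one
-- general fact about models for each way Simpl is built:
--   * single-above: a one-state model with label l and no transitions
--     simulates any model whose root label is contained in l.  This covers
--     Simpl(⊤) (l = Act) and Simpl(!A) (l = A).
--   * prefix-above: if (L , t) ⪯ N and s —a⟶ t in L, then (L , s) ⪯ prefix a N;
--     the simulation for N is extended by relating the fresh root to s.
--     This covers the case ⟨a⟩φ with Simpl(φ) ≠ ⊥.
-- For conjunctions the two induction hypotheses make M a lower bound of
-- Simpl(φ) and Simpl(ψ), hence M is below their glb.  If Simpl(φ) = ⊥ then
-- the induction hypothesis  just M ⪯B nothing  is absurd, so no model
-- satisfies ⟨a⟩φ and the case is vacuous.

open import Defs
open import Data.Maybe using (Maybe; just; nothing)
open import Data.Unit using (tt)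
open import Data.Empty using (⊥-elim)
open import Data.Product using (Σ; _×_; _,_; proj₁; proj₂)
open import Level using (lower)
open import Relation.Binary.PropositionalEquality using (_≡_; refl)

module Simpl-Greatest (Act : Set) where
  open Cath Act

  single-above : ∀ (M : Model) (l : Label) →
                 lab (proj₁ M) (proj₂ M) ⊆L l → M ⪯ single l
  single-above (L , s) l root⊆l = (λ _ y → y ≡ s) , record
    { root   = refl
    ; step   = λ _ ()
    ; labels = λ { refl → root⊆l } }

  prefix-above : ∀ (N : Model) (L : CTS) {s t : State L} (a : Act) →
                 _—_⟶_ L s a t → (L , t) ⪯ N → (L , s) ⪯ prefix a N
  prefix-above (L′ , w) L {s} {t} a s⟶t (R , sim) = R′ , record
    { root   = refl
    ; step   = λ {x} → step′ {x}
    ; labels = λ {x} → labels′ {x} }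
    where
    open IsSimulation sim

    R′ : Maybe (State L′) → State L → Set
    R′ nothing  y = y ≡ s
    R′ (just x) y = R x y

    step′ : ∀ {x y b x′} → R′ x y → ExtStep L′ w a x b x′ →
            Σ (State L) λ y′ → (_—_⟶_ L y b y′) × R′ x′ y′
    step′ {nothing} refl new     = t , s⟶t , root
    step′ {just x}  r    (old p) = step r p

    labels′ : ∀ {x y} → R′ x y → lab L y ⊆L extLab L′ w a x
    labels′ {nothing} _ _ _ = tt
    labels′ {just x}  r     = labels r

  simpl-greatest : ∀ (φ : Form) (M : Model) (S : ModelB) →
                   IsSimpl φ S → M ⊨ φ → just M ⪯B S
  simpl-greatest _ M _ s-top      _    = single-above M all (λ _ _ → tt)
  simpl-greatest _ M _ (s-bang A) M⊨!A = single-above M (fin A) M⊨!A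
  simpl-greatest (φ ∧′ ψ) M _ (s-and {x = Sφ} {y = Sψ} simplφ simplψ glb) (M⊨φ , M⊨ψ) =
    IsGlb.greatest glb (just M)
      (simpl-greatest φ M Sφ simplφ M⊨φ)
      (simpl-greatest ψ M Sψ simplψ M⊨ψ)
  simpl-greatest (⟨ a ⟩ φ) (L , s) _ (s-diaB simplφ) (t , _ , t⊨φ) =
    ⊥-elim (lower (simpl-greatest φ (L , t) nothing simplφ t⊨φ))
  simpl-greatest (⟨ a ⟩ φ) (L , s) _ (s-dia {M = N} simplφ) (t , s⟶t , t⊨φ) =
    prefix-above N L a s⟶t (simpl-greatest φ (L , t) (just N) simplφ t⊨φ)

mainTheorem6 : (Act : Set) → Act →
    let open Cath Act in
    ∀ (φ : Form) (M : Model) (S : ModelB) → IsSimpl φ S → M ⊨ φ → just M ⪯B S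
mainTheorem6 Act _ = Simpl-Greatest.simpl-greatest Act
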